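{- For all $n\ge1$, the list $\mathcal{S}_n$ defined below satisfies $\mathcal{S}_n(1)=\mathsf{e}^n$ and $\mathcal{S}_n(r_n)=\mathsf{u}\,\mathsf{e}^{n-1}\,\mathsf{d}$.
   Context: A Schröder path from $(0,0)$ to $(2n,0)$ is a lattice path using steps $\mathsf{u}=(1,1)$, $\mathsf{d}=(1,-1)$ and $\mathsf{e}=(2,0)$ that never goes below the $x$-axis; it is written as a word in $\mathsf{u},\mathsf{d},\mathsf{e}$. The large Schröder numbers are given by $r_0=1$ and $r_n=r_{n-1}+\sum_{k=1}^n r_{k-1}r_{n-k}$ for $n>0$. Let $B(1)=0$ and $B(i)=r_0+\cdots+r_{i-2}$ for $i>1$. The $j$-th entry of a list $\mathcal{S}_n$ is $\mathcal{S}_n(j)$; for an integer $i$, $\mathcal{S}_n^i(j)=\mathcal{S}_n(j)$ if $i$ is odd and $\mathcal{S}_n^i(j)=\mathcal{S}_n(r_n+1-j)$ if $i$ is even. $\bigoplus$ denotes concatenation of lists in index order (outer index varying slowest), juxtaposition denotes concatenation of words. Let $\mathcal{S}_0=(\emptyset)$ (the empty path), and for $n\ge1$ $$\mathcal{S}_n=\bigoplus_{i=1}^{r_{n-1}}\big(\mathsf{e}\,\mathcal{S}_{n-1}(i)\big)\ \oplus\ \bigoplus_{i=1}^{n}\bigoplus_{j=1}^{r_{i-1}}\bigoplus_{k=1}^{r_{n-i}}\big(\mathsf{u}\,\mathcal{S}_{i-1}^{\,n+i}(j)\,\mathsf{d}\,\mathcal{S}_{n-i}^{\,j+B(i)+1}(k)\big).$$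 -}

module Defs where

open import Data.Nat using (ℕ; zero; suc; _+_; _*_; _∸_)
open import Data.Bool using (Bool; true; false; if_then_else_)
open import Data.List using (List; []; _∷_; _++_; map; concatMap; upTo; replicate)
open import Data.Nat.ListAction using (sum)

-- Steps of a Schröder path: u = (1,1), d = (1,-1), e = (2,0)
data Step : Set where
  u d e : Step

Path : Set
Path = List Step

range1 : ℕ → List ℕ
range1 n = map suc (upTo n)

-- large Schröder numbers: r 0 = 1, r n = r (n-1) + Σ_{k=1}^n r (k-1) r (n-k),
-- computed with fuel (rAux f m is correct whenever m ≤ f)
rAux : ℕ → ℕ → ℕ
rAux _ zero = 1
rAux zero (suc n) = 1 -- unreachable when m ≤ fuel
rAux (suc f) (suc n) =
  rAux f n + sum (map (λ k → rAux f (k ∸ 1) * rAux f (suc n ∸ k)) (range1 (suc n)))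

r : ℕ → ℕ
r n = rAux n n

B : ℕ → ℕ
B i = sum (map r (upTo (i ∸ 1)))

isOdd : ℕ → Bool
isOdd zero = false
isOdd (suc zero) = true
isOdd (suc (suc n)) = isOdd n

-- 1-based entry of a list of paths (the empty path outside the range)
at : List Path → ℕ → Path
at [] _ = []
at (x ∷ xs) zero = []
at (x ∷ xs) (suc zero) = x
at (x ∷ xs) (suc (suc j)) = at xs (suc j)

atPar : ℕ → ℕ → List Path → ℕ → Path
atPar i m Sm j = if isOdd i then at Sm j else at Sm (r m + 1 ∸ j)

build : ℕ → (ℕ → List Path) → List Path
build n prev =
  map (e ∷_) (prev (n ∸ 1))
  ++ concatMap (λ i →
       concatMap (λ j →
         map (λ k → (u ∷ atPar (n + i) (i ∸ 1) (prev (i ∸ 1)) j)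
                    ++ (d ∷ atPar (j + B i + 1) (n ∸ i) (prev (n ∸ i)) k))
             (range1 (r (n ∸ i))))
         (range1 (r (i ∸ 1))))
     (range1 n)

-- SAux f m is S_m whenever m ≤ f
SAux : ℕ → ℕ → List Path
SAux _ zero = [] ∷ []
SAux zero (suc n) = [] -- unreachable when m ≤ fuel
SAux (suc f) (suc n) = build (suc n) (SAux f)

S : ℕ → List Path
S n = SAux n n

module Submission where

-- S_n begins with its e-block e S_{n-1}, so by induction its first entry is e^n.  It ends with
-- the last u-block (i = n, j = r_{n-1}, k = r_0 = 1), i.e. u S^{2n}_{n-1}(r_{n-1}) d; the even
-- exponent 2n reverses S_{n-1}, so this is u S_{n-1}(1) d = u e^{n-1} d.  That it sits at
-- position r_n is because the lengths of the S_n satisfy the recursion of the Schröder numbers.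

open import Defs
open import Data.Nat using (ℕ; zero; suc; _+_; _*_; _≥_; _≤_; _<_; _∸_; z≤n; s≤s)
open import Data.Nat.Properties using (≤-refl; ≤-trans; ≤-pred; m≤m+n; m∸n≤m; n∸n≡0; m+n∸m≡n; +-suc)
open import Data.Nat.ListAction using (sum)
open import Data.Bool using (true; false)
open import Data.Maybe as Maybe using (just)
open import Data.List using (List; []; _∷_; _++_; [_]; map; concatMap; upTo; replicate; length; head; last)
open import Data.List.Properties using (length-++; length-map; length-upTo; map-cong; map-cong-local; last-map; upTo-∷ʳ; ++-identityʳ)
open import Data.List.Relation.Unary.All as All using (All)
open import Data.List.Relation.Unary.All.Properties using (map⁺; all-upTo)
open import Data.Product using (_×_; _,_)
open import Function using (_∘_)
open import Relation.Binary.PropositionalEquality using (_≡_; refl; sym; trans; cong; cong₂)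
open Relation.Binary.PropositionalEquality.≡-Reasoning

private
  variable
    A C : Set

length-concatMap : ∀ (f : A → List C) xs → length (concatMap f xs) ≡ sum (map (λ x → length (f x)) xs)
length-concatMap f [] = refl
length-concatMap f (x ∷ xs) = trans (length-++ (f x)) (cong (length (f x) +_) (length-concatMap f xs))

length-grid : ∀ {D : Set} (g : A → C → D) xs ys →
              length (concatMap (λ x → map (g x) ys) xs) ≡ length xs * length ys
length-grid g [] ys = refl
length-grid g (x ∷ xs) ys = begin
  length (map (g x) ys ++ concatMap (λ x → map (g x) ys) xs) ≡⟨ length-++ (map (g x) ys) ⟩
  length (map (g x) ys) + length (concatMap (λ x → map (g x) ys) xs)
    ≡⟨ cong₂ _+_ (length-map (g x) ys) (length-grid g xs ys) ⟩
  length ys + length xs * length ys ∎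

head-map-++ : ∀ (f : A → C) {xs x} ys → head xs ≡ just x → head (map f xs ++ ys) ≡ just (f x)
head-map-++ f {_ ∷ _} ys refl = refl

last-++ : ∀ xs {ys} {y : A} → last ys ≡ just y → last (xs ++ ys) ≡ just y
last-++ [] eq = eq
last-++ (x ∷ []) {_ ∷ _} eq = eq
last-++ (x ∷ x′ ∷ xs) eq = last-++ (x′ ∷ xs) eq

last-concatMap : ∀ (f : A → List C) xs {y z} → last xs ≡ just y → last (f y) ≡ just z →
                 last (concatMap f xs) ≡ just z
last-concatMap f (y ∷ []) refl eq = trans (cong last (++-identityʳ (f y))) eq
last-concatMap f (x ∷ x′ ∷ xs) eq₁ eq₂ = last-++ (f x) (last-concatMap f (x′ ∷ xs) eq₁ eq₂)

range1-bounds : ∀ n → All (λ i → i ∸ 1 < n × n ∸ i < n) (range1 n)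
range1-bounds n = map⁺ (All.map bounds (all-upTo n))
  where
  bounds : ∀ {j n} → j < n → j < n × n ∸ suc j < n
  bounds {j} {suc k} (s≤s j≤k) = s≤s j≤k , s≤s (m∸n≤m k j)

length-range1 : ∀ n → length (range1 n) ≡ n
length-range1 n = trans (length-map suc (upTo n)) (length-upTo n)

last-range1 : ∀ {n} → 1 ≤ n → last (range1 n) ≡ just n
last-range1 {suc n} _ = begin
  last (map suc (upTo (suc n)))        ≡⟨ last-map suc (upTo (suc n)) ⟩
  Maybe.map suc (last (upTo (suc n)))  ≡⟨ cong (Maybe.map suc ∘ last) (sym (upTo-∷ʳ n)) ⟩
  Maybe.map suc (last (upTo n ++ [ n ])) ≡⟨ cong (Maybe.map suc) (last-++ (upTo n) refl) ⟩
  just (suc n)                         ∎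

rAux-fuel : ∀ {f g} k → k ≤ f → k ≤ g → rAux f k ≡ rAux g k
rAux-fuel zero _ _ = refl
rAux-fuel {suc f} {suc g} (suc k) (s≤s k≤f) (s≤s k≤g) =
  cong₂ _+_ (rAux-fuel k k≤f k≤g)
            (cong sum (map-cong-local (All.map (λ {i} → summand {i}) (range1-bounds (suc k)))))
  where
  summand : ∀ {i} → i ∸ 1 < suc k × suc k ∸ i < suc k →
            rAux f (i ∸ 1) * rAux f (suc k ∸ i) ≡ rAux g (i ∸ 1) * rAux g (suc k ∸ i)
  summand {i} (lo , hi) =
    cong₂ _*_ (rAux-fuel (i ∸ 1) (≤-trans (≤-pred lo) k≤f) (≤-trans (≤-pred lo) k≤g))
              (rAux-fuel (suc k ∸ i) (≤-trans (≤-pred hi) k≤f) (≤-trans (≤-pred hi) k≤g))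

convolution : ℕ → ℕ
convolution n = sum (map (λ i → r (i ∸ 1) * r (n ∸ i)) (range1 n))

r-suc : ∀ n → r (suc n) ≡ r n + convolution (suc n)
r-suc n =
  cong (r n +_) (cong sum (map-cong-local (All.map (λ {i} → fuel {i}) (range1-bounds (suc n)))))
  where
  fuel : ∀ {i} → i ∸ 1 < suc n × suc n ∸ i < suc n →
         rAux n (i ∸ 1) * rAux n (suc n ∸ i) ≡ r (i ∸ 1) * r (suc n ∸ i)
  fuel {i} (lo , hi) = cong₂ _*_ (rAux-fuel (i ∸ 1) (≤-pred lo) ≤-refl)
                                 (rAux-fuel (suc n ∸ i) (≤-pred hi) ≤-refl)

r-positive : ∀ n → 1 ≤ r n
r-positive zero = s≤s z≤n
r-positive (suc n) rewrite r-suc n = ≤-trans (r-positive n) (m≤m+n (r n) _)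

at-head : ∀ {xs x} → head xs ≡ just x → at xs 1 ≡ x
at-head {_ ∷ _} refl = refl

at-last : ∀ {xs x} → last xs ≡ just x → at xs (length xs) ≡ x
at-last {_ ∷ []} refl = refl
at-last {_ ∷ y ∷ xs} eq = at-last {y ∷ xs} eq

isOdd-double : ∀ n → isOdd (n + n) ≡ false
isOdd-double zero = refl
isOdd-double (suc n) rewrite +-suc n n = isOdd-double n

atPar-double-r : ∀ n m xs → atPar (n + n) m xs (r m) ≡ at xs 1
atPar-double-r n m xs rewrite isOdd-double n | m+n∸m≡n (r m) 1 = refl

at-[[]] : ∀ j → at ([] ∷ []) j ≡ []
at-[[]] zero = refl
at-[[]] (suc zero) = refl
at-[[]] (suc (suc j)) = refl

atPar-[[]] : ∀ i j → atPar i 0 ([] ∷ []) j ≡ []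
atPar-[[]] i j with isOdd i
... | true = at-[[]] j
... | false = at-[[]] (2 ∸ j)

atPar-[[]]-∸ : ∀ i n (prev : ℕ → List Path) j → prev 0 ≡ [] ∷ [] →
               atPar i (n ∸ n) (prev (n ∸ n)) j ≡ []
atPar-[[]]-∸ i n prev j prev₀ rewrite n∸n≡0 n | prev₀ = atPar-[[]] i j

-- The paths u S^{n+i}_{i-1}(j) d S^{j+B(i)+1}_{n-i}(k) of the second part of build n prev,
-- whose first return to the axis is at abscissa 2i; build n prev unfolds definitionally to
-- map (e ∷_) (prev (n ∸ 1)) ++ concatMap (firstReturnBlock n prev) (range1 n).
firstReturnPath : ℕ → (ℕ → List Path) → ℕ → ℕ → ℕ → Path
firstReturnPath n prev i j k =
  (u ∷ atPar (n + i) (i ∸ 1) (prev (i ∸ 1)) j) ++ (d ∷ atPar (j + B i + 1) (n ∸ i) (prev (n ∸ i)) k)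

firstReturnBlock : ℕ → (ℕ → List Path) → ℕ → List Path
firstReturnBlock n prev i =
  concatMap (λ j → map (firstReturnPath n prev i j) (range1 (r (n ∸ i)))) (range1 (r (i ∸ 1)))

length-firstReturnBlock : ∀ n prev i → length (firstReturnBlock n prev i) ≡ r (i ∸ 1) * r (n ∸ i)
length-firstReturnBlock n prev i =
  trans (length-grid (firstReturnPath n prev i) (range1 (r (i ∸ 1))) (range1 (r (n ∸ i))))
        (cong₂ _*_ (length-range1 (r (i ∸ 1))) (length-range1 (r (n ∸ i))))

length-build : ∀ n prev → length (build n prev) ≡ length (prev (n ∸ 1)) + convolution n
length-build n prev = begin
  length (map (e ∷_) (prev (n ∸ 1)) ++ concatMap (firstReturnBlock n prev) (range1 n))
    ≡⟨ length-++ (map (e ∷_) (prev (n ∸ 1))) ⟩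
  length (map (e ∷_) (prev (n ∸ 1))) + length (concatMap (firstReturnBlock n prev) (range1 n))
    ≡⟨ cong₂ _+_ (length-map (e ∷_) (prev (n ∸ 1)))
                 (length-concatMap (firstReturnBlock n prev) (range1 n)) ⟩
  length (prev (n ∸ 1)) + sum (map (length ∘ firstReturnBlock n prev) (range1 n))
    ≡⟨ cong (λ ls → length (prev (n ∸ 1)) + sum ls)
            (map-cong (length-firstReturnBlock n prev) (range1 n)) ⟩
  length (prev (n ∸ 1)) + convolution n ∎

length-S : ∀ n → length (S n) ≡ r n
length-S zero = refl
length-S (suc m) = begin
  length (build (suc m) (SAux m))    ≡⟨ length-build (suc m) (SAux m) ⟩
  length (S m) + convolution (suc m) ≡⟨ cong (_+ convolution (suc m)) (length-S m) ⟩
  r m + convolution (suc m)          ≡⟨ sym (r-suc m) ⟩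
  r (suc m)                          ∎

last-build : ∀ m (prev : ℕ → List Path) → prev 0 ≡ [] ∷ [] →
             last (build (suc m) prev) ≡ just (u ∷ atPar (suc m + suc m) m (prev m) (r m) ++ d ∷ [])
last-build m prev prev₀ =
  last-++ (map (e ∷_) (prev m))
    (last-concatMap (firstReturnBlock n prev) (range1 n) (last-range1 {n} (s≤s z≤n))
      (last-concatMap (λ j → map (firstReturnPath n prev n j) (range1 (r (n ∸ n))))
                      (range1 (r m)) (last-range1 (r-positive m))
        (begin
          last (map (firstReturnPath n prev n (r m)) (range1 (r (n ∸ n))))
            ≡⟨ last-map (firstReturnPath n prev n (r m)) (range1 (r (n ∸ n))) ⟩
          Maybe.map (firstReturnPath n prev n (r m)) (last (range1 (r (n ∸ n))))
            ≡⟨ cong (Maybe.map (firstReturnPath n prev n (r m))) (last-range1 (r-positive (n ∸ n))) ⟩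
          just (firstReturnPath n prev n (r m) (r (n ∸ n)))
            ≡⟨ cong (λ q → just (u ∷ atPar (n + n) m (prev m) (r m) ++ d ∷ q))
                    (atPar-[[]]-∸ (r m + B n + 1) n prev (r (n ∸ n)) prev₀) ⟩
          just (u ∷ atPar (n + n) m (prev m) (r m) ++ d ∷ []) ∎)))
  where
  n : ℕ
  n = suc m

head-S : ∀ n → head (S n) ≡ just (replicate n e)
head-S zero = refl
head-S (suc m) =
  head-map-++ (e ∷_) (concatMap (firstReturnBlock (suc m) (SAux m)) (range1 (suc m))) (head-S m)

lemma3p2 : (n : ℕ) → n ≥ 1 →
    (at (S n) 1 ≡ replicate n e) × (at (S n) (r n) ≡ u ∷ (replicate (n ∸ 1) e ++ (d ∷ [])))
lemma3p2 (suc m) _ = at-head (head-S (suc m)) , last-entry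
  where
  last-entry : at (S (suc m)) (r (suc m)) ≡ u ∷ (replicate m e ++ (d ∷ []))
  last-entry = begin
    at (S (suc m)) (r (suc m))
      ≡⟨ cong (at (S (suc m))) (sym (length-S (suc m))) ⟩
    at (S (suc m)) (length (S (suc m)))
      ≡⟨ at-last {S (suc m)} (last-build m (SAux m) refl) ⟩
    u ∷ atPar (suc m + suc m) m (S m) (r m) ++ d ∷ []
      ≡⟨ cong (λ p → u ∷ p ++ d ∷ []) (trans (atPar-double-r (suc m) m (S m)) (at-head (head-S m))) ⟩
    u ∷ replicate m e ++ d ∷ [] ∎
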